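{- Let $a,b$ be positive integers with $1\le a<b$, and let $G$ be a finite simple graph with minimum degree $\delta(G)\geq a+2$. If $G-\{x,y\}$ has an $[a,b]$-factor for every pair of distinct vertices $x,y\in V(G)$, then $G-e$ has an $[a,b]$-factor for every edge $e\in E(G)$.
   Context: A spanning subgraph $H$ of $G$ is an $[a,b]$-factor if $a\le d_H(x)\le b$ for every $x\in V(G)$. $G-e$ denotes $G$ with the edge $e$ removed (all vertices kept). -}

module Defs where

open import Data.Nat using (ℕ; zero; suc; _≤_)
open import Data.Bool using (Bool; true; false; _∧_; not; T)
open import Data.Fin using (Fin)
open import Data.Fin.Properties using (_≟_)
open import Data.List using (List; filter; length)
open import Data.List.Base using (allFin)
open import Data.Product using (_×_)
open import Relation.Nullary.Decidable using (does)
open import Relation.Binary.PropositionalEquality using (_≡_)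

record Graph (n : ℕ) : Set where
  field
    adj   : Fin n → Fin n → Bool
    sym   : ∀ u v → adj u v ≡ adj v u
    irrefl : ∀ v → adj v v ≡ false
open Graph public

deg : ∀ {n} → (Fin n → Fin n → Bool) → Fin n → ℕ
deg {n} r v = length (filter (λ w → T? (r v w)) (allFin n))
  where
  open import Data.Bool.Properties using (T?)

minDeg≥ : ∀ {n} → Graph n → ℕ → Set
minDeg≥ G k = ∀ v → k ≤ deg (adj G) v

record Factor {n} (S : Fin n → Bool) (r : Fin n → Fin n → Bool) (a b : ℕ) : Set where
  field
    H      : Fin n → Fin n → Bool
    H-sym  : ∀ u v → H u v ≡ H v u
    H-sub  : ∀ u v → T (H u v) → T (r u v)
    H-inS  : ∀ u v → T (H u v) → T (S u) × T (S v)
    deg-lo : ∀ v → T (S v) → a ≤ deg H v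
    deg-hi : ∀ v → T (S v) → deg H v ≤ b

allBut₂ : ∀ {n} → Fin n → Fin n → Fin n → Bool
allBut₂ x y v = not (does (v ≟ x)) ∧ not (does (v ≟ y))

HasFactorMinus₂ : ∀ {n} → Graph n → Fin n → Fin n → ℕ → ℕ → Set
HasFactorMinus₂ G x y a b = Factor (allBut₂ x y) (adj G) a b

delEdge : ∀ {n} → (Fin n → Fin n → Bool) → Fin n → Fin n → Fin n → Fin n → Bool
delEdge r x y u v =
  r u v ∧ not ((does (u ≟ x) ∧ does (v ≟ y)) Data.Bool.∨ (does (u ≟ y) ∧ does (v ≟ x)))

HasFactorMinusEdge : ∀ {n} → Graph n → Fin n → Fin n → ℕ → ℕ → Set
HasFactorMinusEdge G x y a b = Factor (λ _ → true) (delEdge (adj G) x y) a b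

-- Grow a subgraph D of G − e of maximum degree at most b, starting from the empty one and
-- decreasing the potential Σ_w ω(w) · (a ∸ d_D(w)), where ω is 1 at the ends x, y of e and 2
-- elsewhere; once no vertex is deficient, D is the required [a,b]-factor.
--
-- The basic move augments D towards a target C ⊆ G − e: from a vertex s with d_D(s) < d_C(s)
-- an alternating walk in the symmetric difference of D and C raises d(s), while at most one
-- other vertex moves one step towards its C-degree. A deficient s ∉ {x, y} is pushed towards
-- an [a,b]-factor of G − {x, y}, which avoids e; only x or y can then lose, at half the weight.
-- For a deficient end s of e, with other end r, both s and r keep a + 1 neighbours in G − e as
-- δ(G) ≥ a + 2. Either a neighbour of s not joined to it in D has spare capacity, or s is pushed
-- towards a factor of G − {r, t} or of G − {u, v} for saturated neighbours t, v of s and u of r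
-- (rerouting the edge sr of such a factor through ru and sv). A vertex that loses then had degree
-- above a or has target degree at least a, so no deficiency is created.

module Submission where

open import Defs hiding (sym)
open import Data.Nat using (ℕ; zero; suc; _+_; _*_; _∸_; _≤_; _<_; z≤n; s≤s; _<?_)
open import Data.Nat.Properties
  using (≤-refl; ≤-trans; ≤-reflexive; <-≤-trans; ≤-<-trans; <-trans; <⇒≱; ≮⇒≥; ≤-pred; n≤1+n; m≤m+n;
         suc-injective; +-comm; +-assoc; +-suc; +-identityʳ; +-mono-≤; +-monoˡ-≤; +-cancelˡ-≤; +-cancelʳ-≤;
         +-cancelʳ-≡; *-suc; *-identityˡ; *-zeroʳ; *-monoʳ-≤; *-monoʳ-<; ∸-monoʳ-≤; ∸-monoʳ-<; m≤n⇒m∸n≡0;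
         +-0-commutativeMonoid; module ≤-Reasoning)
open import Data.Nat.Solver using (module +-*-Solver)
open import Data.Nat.Induction using (<-wellFounded)
open import Induction.WellFounded using (Acc; acc)
open import Algebra.Properties.CommutativeMonoid.Sum +-0-commutativeMonoid
  using (sum; sum-cong-≗; sum-remove; ∑-distrib-+; sum-replicate-zero)
open import Data.Bool using (Bool; true; false; _∧_; _∨_; not; _xor_; if_then_else_; T)
open import Data.Bool.Properties
  using (T?; T-≡; ∧-comm; ∨-comm; ∧-zeroʳ; ∧-identityʳ; not-involutive) renaming (_≟_ to _≟ᵇ_)
open import Function.Bundles using (Equivalence)
open import Data.Fin using (Fin; zero; suc; punchIn)
open import Data.Fin.Properties using (_≟_; any?; punchInᵢ≢i)
open import Data.List using (filter; length; tabulate)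
open import Data.Product using (Σ; _×_; _,_; proj₁; proj₂)
open import Data.Sum using (_⊎_; inj₁; inj₂; [_,_]′)
open import Data.Unit using (tt)
open import Data.Empty using (⊥-elim)
open import Relation.Nullary using (¬_; Dec; yes; no; contradiction)
open import Relation.Nullary.Decidable using (does; _×-dec_)
open import Relation.Binary.PropositionalEquality

-- Counting over Fin n

𝟙 : Bool → ℕ
𝟙 true  = 1
𝟙 false = 0

count : ∀ {n} → (Fin n → Bool) → ℕ
count f = sum (λ i → 𝟙 (f i))

δ : ∀ {n} → Fin n → ℕ → Fin n → ℕ
δ i k j = if does (j ≟ i) then k else 0

sum-δ : ∀ {n} (i : Fin n) k → sum (δ i k) ≡ k
sum-δ {suc n} i k = begin
  sum (δ i k)                                ≡⟨ sum-remove {i = i} (δ i k) ⟩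
  δ i k i + sum (λ j → δ i k (punchIn i j))  ≡⟨ cong₂ _+_ diag (sum-cong-≗ (λ j → off (punchInᵢ≢i i j))) ⟩
  k + sum {n} (λ _ → 0)                      ≡⟨ cong (k +_) (sum-replicate-zero n) ⟩
  k + 0                                      ≡⟨ +-identityʳ k ⟩
  k                                          ∎
  where
  open ≡-Reasoning
  diag : δ i k i ≡ k
  diag with i ≟ i
  ... | yes _  = refl
  ... | no i≢i = contradiction refl i≢i
  off : ∀ {j} → j ≢ i → δ i k j ≡ 0
  off {j} j≢i with j ≟ i
  ... | yes j≡i = contradiction j≡i j≢i
  ... | no _    = refl

sum-mono : ∀ {n} (f g : Fin n → ℕ) → (∀ i → f i ≤ g i) → sum f ≤ sum g
sum-mono {zero}  f g f≤g = z≤n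
sum-mono {suc n} f g f≤g = +-mono-≤ (f≤g zero) (sum-mono (λ i → f (suc i)) (λ i → g (suc i)) (λ i → f≤g (suc i)))

sum-mono-+ : ∀ {n} (f g f′ g′ : Fin n → ℕ) → (∀ i → f i + g i ≤ f′ i + g′ i) → sum f + sum g ≤ sum f′ + sum g′
sum-mono-+ f g f′ g′ le = begin
  sum f + sum g                  ≡⟨ sym (∑-distrib-+ f g) ⟩
  sum (λ i → f i + g i)          ≤⟨ sum-mono _ _ le ⟩
  sum (λ i → f′ i + g′ i)        ≡⟨ ∑-distrib-+ f′ g′ ⟩
  sum f′ + sum g′                ∎
  where open ≤-Reasoning

sum-<-at : ∀ {n} (f′ f : Fin n → ℕ) (s : Fin n) → f′ s < f s → (∀ w → w ≢ s → f′ w ≤ f w) → sum f′ < sum f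
sum-<-at f′ f s lt le = subst₂ _≤_ (trans (cong (sum f′ +_) (sum-δ s 1)) (+-comm _ 1))
                                   (trans (cong (sum f +_) (sum-δ s 0)) (+-identityʳ _))
                                   (sum-mono-+ f′ (δ s 1) f (δ s 0) pointwise)
  where
  pointwise : ∀ w → f′ w + δ s 1 w ≤ f w + δ s 0 w
  pointwise w with w ≟ s
  ... | yes refl = subst₂ _≤_ (+-comm 1 _) (sym (+-identityʳ _)) lt
  ... | no w≢s   = +-monoˡ-≤ 0 (le w w≢s)

sum-<-trade : ∀ {n} (f′ f : Fin n → ℕ) (s z : Fin n) → z ≢ s → f′ s + 2 ≤ f s → f′ z ≤ f z + 1 →
              (∀ w → w ≢ s → w ≢ z → f′ w ≤ f w) → sum f′ < sum f
sum-<-trade f′ f s z z≢s gain loss le = +-cancelʳ-≤ 1 (suc (sum f′)) (sum f)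
  (subst₂ _≤_ (trans (cong (sum f′ +_) (sum-δ s 2)) (+-suc (sum f′) 1)) (cong (sum f +_) (sum-δ z 1))
              (sum-mono-+ f′ (δ s 2) f (δ z 1) pointwise))
  where
  pointwise : ∀ w → f′ w + δ s 2 w ≤ f w + δ z 1 w
  pointwise w with w ≟ s | w ≟ z
  ... | yes refl | yes w≡z  = contradiction (sym w≡z) z≢s
  ... | yes refl | no _     = ≤-trans gain (≤-reflexive (sym (+-identityʳ _)))
  ... | no _     | yes refl = ≤-trans (≤-reflexive (+-identityʳ _)) loss
  ... | no w≢s   | no w≢z   = +-monoˡ-≤ 0 (le w w≢s w≢z)

count-cong : ∀ {n} (f g : Fin n → Bool) → (∀ i → f i ≡ g i) → count f ≡ count g
count-cong f g f≗g = sum-cong-≗ (λ i → cong 𝟙 (f≗g i))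

count-mono : ∀ {n} (f g : Fin n → Bool) → (∀ i → f i ≡ true → g i ≡ true) → count f ≤ count g
count-mono f g f⊆g = sum-mono _ _ (λ i → 𝟙-mono (f⊆g i))
  where
  𝟙-mono : ∀ {b c} → (b ≡ true → c ≡ true) → 𝟙 b ≤ 𝟙 c
  𝟙-mono {false} _   = z≤n
  𝟙-mono {true}  b⇒c rewrite b⇒c refl = ≤-refl

count-none : ∀ {n} (f : Fin n → Bool) → (∀ i → f i ≡ false) → count f ≡ 0
count-none {n} f none = trans (sum-cong-≗ (λ i → cong 𝟙 (none i))) (sum-replicate-zero n)

count-witness : ∀ {n} (f g : Fin n → Bool) → count f < count g → Σ (Fin n) λ i → g i ≡ true × f i ≡ false
count-witness f g lt with any? (λ i → g i ≟ᵇ true ×-dec f i ≟ᵇ false)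
... | yes found = found
... | no none   = contradiction (count-mono g f g⊆f) (<⇒≱ lt)
  where
  g⊆f : ∀ i → g i ≡ true → f i ≡ true
  g⊆f i gi with f i in fi
  ... | true  = refl
  ... | false = contradiction (i , gi , fi) none

count-nonempty : ∀ {n} (f : Fin n → Bool) → 1 ≤ count f → Σ (Fin n) λ i → f i ≡ true
count-nonempty {n} f pos with count-witness (λ _ → false) f (subst (_< count f) (sym nothing) pos)
  where
  nothing : count {n} (λ _ → false) ≡ 0
  nothing = count-none {n} _ (λ _ → refl)
... | i , fi , _ = i , fi

count-not : ∀ {n} (f : Fin n → Bool) → count (λ i → not (f i)) + count f ≡ n
count-not {zero}  f = refl
count-not {suc n} f with f zero
... | true  = trans (+-suc _ _) (cong suc (count-not (λ i → f (suc i))))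
... | false = cong suc (count-not (λ i → f (suc i)))

count-∧-split : ∀ {n} (f g : Fin n → Bool) → count f ≡ count (λ i → f i ∧ g i) + count (λ i → f i ∧ not (g i))
count-∧-split f g = trans (sum-cong-≗ (λ i → split (f i) (g i)))
                          (∑-distrib-+ (λ i → 𝟙 (f i ∧ g i)) (λ i → 𝟙 (f i ∧ not (g i))))
  where
  split : ∀ b c → 𝟙 b ≡ 𝟙 (b ∧ c) + 𝟙 (b ∧ not c)
  split false _     = refl
  split true  true  = refl
  split true  false = refl

count-remove : ∀ {n} (f : Fin (suc n) → Bool) (i : Fin (suc n)) → count f ≡ 𝟙 (f i) + count (λ j → f (punchIn i j))
count-remove f i = sum-remove {i = i} (λ j → 𝟙 (f j))

count-update : ∀ {n} (f g : Fin n → Bool) (q : Fin n) → (∀ i → i ≢ q → f i ≡ g i) →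
               count f + 𝟙 (g q) ≡ count g + 𝟙 (f q)
count-update {suc n} f g q agree = begin
  count f + 𝟙 (g q)                                  ≡⟨ cong (_+ 𝟙 (g q)) (count-remove f q) ⟩
  𝟙 (f q) + count (λ j → f (punchIn q j)) + 𝟙 (g q)  ≡⟨ cong (λ m → 𝟙 (f q) + m + 𝟙 (g q)) rest ⟩
  𝟙 (f q) + count (λ j → g (punchIn q j)) + 𝟙 (g q)  ≡⟨ swap (𝟙 (f q)) (count (λ j → g (punchIn q j))) (𝟙 (g q)) ⟩
  𝟙 (g q) + count (λ j → g (punchIn q j)) + 𝟙 (f q)  ≡⟨ cong (_+ 𝟙 (f q)) (sym (count-remove g q)) ⟩
  count g + 𝟙 (f q)                                  ∎
  where
  open ≡-Reasoning
  open +-*-Solver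
  rest : count (λ j → f (punchIn q j)) ≡ count (λ j → g (punchIn q j))
  rest = count-cong _ _ (λ j → agree (punchIn q j) (punchInᵢ≢i q j))
  swap : ∀ x m y → x + m + y ≡ y + m + x
  swap = solve 3 (λ x m y → x :+ m :+ y := y :+ m :+ x) refl

count-avoiding : ∀ {n} (f : Fin n → Bool) → 2 ≤ count f → (u : Fin n) → Σ (Fin n) λ i → i ≢ u × f i ≡ true
count-avoiding {suc n} f two u with count-nonempty (λ j → f (punchIn u j)) rest
  where
  𝟙≤1 : ∀ b → 𝟙 b ≤ 1
  𝟙≤1 true  = ≤-refl
  𝟙≤1 false = z≤n
  rest : 1 ≤ count (λ j → f (punchIn u j))
  rest = +-cancelˡ-≤ 1 1 _ (≤-trans two (≤-trans (≤-reflexive (count-remove f u)) (+-monoˡ-≤ _ (𝟙≤1 (f u)))))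
... | j , fj = punchIn u j , punchInᵢ≢i u j , fj

-- Adjacency relations and edge updates

Adj : ℕ → Set
Adj n = Fin n → Fin n → Bool

length-filter-tabulate : ∀ {m n} (h : Fin m → Fin n) (g : Fin n → Bool) →
  length (filter (λ w → T? (g w)) (tabulate h)) ≡ count (λ i → g (h i))
length-filter-tabulate {zero}  h g = refl
length-filter-tabulate {suc m} h g with g (h zero)
... | true  = cong suc (length-filter-tabulate (λ i → h (suc i)) g)
... | false = length-filter-tabulate (λ i → h (suc i)) g

module _ {n : ℕ} where

  degree : Adj n → Fin n → ℕ
  degree R w = count (R w)

  deg≡degree : (R : Adj n) (w : Fin n) → deg R w ≡ degree R w
  deg≡degree R w = length-filter-tabulate (λ i → i) (R w)

  Sym : Adj n → Set
  Sym R = ∀ u v → R u v ≡ R v u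

  ∁ : Adj n → Adj n
  ∁ R u v = not (R u v)

  ∁-sym : (R : Adj n) → Sym R → Sym (∁ R)
  ∁-sym R sym u v = cong not (sym u v)

  degree-∁ : (R : Adj n) (w : Fin n) → degree (∁ R) w + degree R w ≡ n
  degree-∁ R w = count-not (R w)

  degree+degree-∁ : (R : Adj n) (w : Fin n) → degree R w + degree (∁ R) w ≡ n
  degree+degree-∁ R w = trans (+-comm (degree R w) _) (degree-∁ R w)

  Pair : Fin n → Fin n → Fin n → Fin n → Set
  Pair p q u v = (u ≡ p × v ≡ q) ⊎ (u ≡ q × v ≡ p)

  -- Spelled out so that delEdge R x y u v is R u v ∧ not (isPair x y u v) by definition.
  isPair : Fin n → Fin n → Fin n → Fin n → Bool
  isPair p q u v = (does (u ≟ p) ∧ does (v ≟ q)) ∨ (does (u ≟ q) ∧ does (v ≟ p))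

  isPair-true : ∀ p q u v → isPair p q u v ≡ true → Pair p q u v
  isPair-true p q u v h with u ≟ p | v ≟ q | u ≟ q | v ≟ p
  ... | yes u≡p | yes v≡q | _       | _       = inj₁ (u≡p , v≡q)
  ... | _       | _       | yes u≡q | yes v≡p = inj₂ (u≡q , v≡p)
  ... | yes _   | no _    | yes _   | no _    = contradiction h λ ()
  ... | yes _   | no _    | no _    | _       = contradiction h λ ()
  ... | no _    | _       | yes _   | no _    = contradiction h λ ()
  ... | no _    | _       | no _    | _       = contradiction h λ ()

  isPair-false : ∀ p q u v → ¬ Pair p q u v → isPair p q u v ≡ false
  isPair-false p q u v ¬pair with isPair p q u v in eq
  ... | true  = contradiction (isPair-true p q u v eq) ¬pair
  ... | false = refl

  isPair-sym : ∀ p q u v → isPair p q u v ≡ isPair p q v u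
  isPair-sym p q u v = trans (∨-comm (does (u ≟ p) ∧ does (v ≟ q)) _)
                             (cong₂ _∨_ (∧-comm (does (u ≟ q)) _) (∧-comm (does (u ≟ p)) _))

  isPair-comm : ∀ p q u v → isPair p q u v ≡ isPair q p u v
  isPair-comm p q u v = ∨-comm (does (u ≟ p) ∧ does (v ≟ q)) _

  isPair-refl : ∀ p q → isPair p q p q ≡ true
  isPair-refl p q with p ≟ p | q ≟ q
  ... | yes _ | yes _ = refl
  ... | no p≢p | _    = contradiction refl p≢p
  ... | yes _ | no q≢q = contradiction refl q≢q

  isPair-pair : ∀ {p q u v} → Pair p q u v → isPair p q u v ≡ true
  isPair-pair {p} {q} (inj₁ (refl , refl)) = isPair-refl p q
  isPair-pair {p} {q} (inj₂ (refl , refl)) = trans (isPair-sym p q q p) (isPair-refl p q)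

  setEdge : Adj n → Fin n → Fin n → Bool → Adj n
  setEdge R p q β u v = if isPair p q u v then β else R u v

  module _ (R : Adj n) (p q : Fin n) (β : Bool) where

    setEdge-off : ∀ u v → ¬ Pair p q u v → setEdge R p q β u v ≡ R u v
    setEdge-off u v ¬pair rewrite isPair-false p q u v ¬pair = refl

    setEdge-on : setEdge R p q β p q ≡ β
    setEdge-on rewrite isPair-refl p q = refl

    setEdge-comm : ∀ u v → setEdge R p q β u v ≡ setEdge R q p β u v
    setEdge-comm u v rewrite isPair-comm p q u v = refl

    setEdge-sym : Sym R → Sym (setEdge R p q β)
    setEdge-sym sym u v rewrite isPair-sym p q u v with isPair p q v u
    ... | true  = refl
    ... | false = sym u v

    setEdge-diag : p ≢ q → ∀ u → setEdge R p q β u u ≡ R u u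
    setEdge-diag p≢q u = setEdge-off u u λ { (inj₁ (u≡p , u≡q)) → p≢q (trans (sym u≡p) u≡q)
                                           ; (inj₂ (u≡q , u≡p)) → p≢q (trans (sym u≡p) u≡q) }

    degree-setEdge-off : ∀ w → w ≢ p → w ≢ q → degree (setEdge R p q β) w ≡ degree R w
    degree-setEdge-off w w≢p w≢q = count-cong _ _ (λ v → setEdge-off w v
      λ { (inj₁ (w≡p , _)) → w≢p w≡p ; (inj₂ (w≡q , _)) → w≢q w≡q })

    degree-setEdgeˡ : p ≢ q → degree (setEdge R p q β) p + 𝟙 (R p q) ≡ degree R p + 𝟙 β
    degree-setEdgeˡ p≢q = subst (λ c → degree (setEdge R p q β) p + 𝟙 (R p q) ≡ degree R p + 𝟙 c) setEdge-on
      (count-update (setEdge R p q β p) (R p) q λ v v≢q → setEdge-off p v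
        λ { (inj₁ (_ , v≡q)) → v≢q v≡q ; (inj₂ (p≡q , _)) → p≢q p≡q })

  module _ (R : Adj n) (p q : Fin n) (p≢q : p ≢ q) where

    degree-setEdgeʳ : ∀ β → degree (setEdge R p q β) q + 𝟙 (R q p) ≡ degree R q + 𝟙 β
    degree-setEdgeʳ β = trans (cong (_+ 𝟙 (R q p)) (count-cong _ _ (setEdge-comm R p q β q)))
                              (degree-setEdgeˡ R q p β (≢-sym p≢q))

    private
      gained : ∀ {d′ d} → d′ + 0 ≡ d + 1 → d′ ≡ suc d
      gained {d′} {d} e = trans (sym (+-identityʳ d′)) (trans e (+-comm d 1))

      lost : ∀ {d′ d} → d′ + 1 ≡ d + 0 → suc d′ ≡ d
      lost {d′} {d} e = trans (+-comm 1 d′) (trans e (+-identityʳ d))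

    degree-addEdgeˡ : R p q ≡ false → degree (setEdge R p q true) p ≡ suc (degree R p)
    degree-addEdgeˡ absent =
      gained (trans (cong (λ c → degree (setEdge R p q true) p + 𝟙 c) (sym absent)) (degree-setEdgeˡ R p q true p≢q))

    degree-addEdgeʳ : R q p ≡ false → degree (setEdge R p q true) q ≡ suc (degree R q)
    degree-addEdgeʳ absent =
      gained (trans (cong (λ c → degree (setEdge R p q true) q + 𝟙 c) (sym absent)) (degree-setEdgeʳ true))

    degree-removeEdgeˡ : R p q ≡ true → suc (degree (setEdge R p q false) p) ≡ degree R p
    degree-removeEdgeˡ present =
      lost (trans (cong (λ c → degree (setEdge R p q false) p + 𝟙 c) (sym present)) (degree-setEdgeˡ R p q false p≢q))

    degree-removeEdgeʳ : R q p ≡ true → suc (degree (setEdge R p q false) q) ≡ degree R q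
    degree-removeEdgeʳ present =
      lost (trans (cong (λ c → degree (setEdge R p q false) q + 𝟙 c) (sym present)) (degree-setEdgeʳ false))

  reroute : Adj n → Fin n → Fin n → Fin n → Fin n → Adj n
  reroute H s r u v = setEdge (setEdge (setEdge H s r false) r u true) s v true

  reroute-true : ∀ H s r u v i j → reroute H s r u v i j ≡ true →
                 Pair s v i j ⊎ Pair r u i j ⊎ (¬ Pair s r i j × H i j ≡ true)
  reroute-true H s r u v i j h with isPair s v i j in sv
  ... | true = inj₁ (isPair-true s v i j sv)
  ... | false with isPair r u i j in ru
  ...   | true = inj₂ (inj₁ (isPair-true r u i j ru))
  ...   | false with isPair s r i j in sr
  ...     | true  = contradiction h λ ()
  ...     | false = inj₂ (inj₂ ((λ pair → contradiction (trans (sym sr) (isPair-pair pair)) λ ()) , h))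

  module Reroute (H : Adj n) (symH : Sym H) {s r u v : Fin n}
                 (s≢r : s ≢ r) (s≢u : s ≢ u) (s≢v : s ≢ v) (r≢u : r ≢ u) (r≢v : r ≢ v) (u≢v : u ≢ v)
                 (Hsr : H s r ≡ true) (Hru : H r u ≡ false) (Hsv : H s v ≡ false) where

    private
      H₁ = setEdge H s r false
      H₂ = setEdge H₁ r u true
      H₂-sym : Sym H₂
      H₂-sym = setEdge-sym H₁ r u true (setEdge-sym H s r false symH)
      H₁ru : H₁ r u ≡ false
      H₁ru = trans (setEdge-off H s r false r u λ { (inj₁ (r≡s , _)) → s≢r (sym r≡s)
                                                  ; (inj₂ (_ , u≡s)) → s≢u (sym u≡s) }) Hru
      H₂sv : H₂ s v ≡ false
      H₂sv = trans (setEdge-off H₁ r u true s v λ { (inj₁ (s≡r , _)) → s≢r s≡r ; (inj₂ (s≡u , _)) → s≢u s≡u })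
             (trans (setEdge-off H s r false s v λ { (inj₁ (_ , v≡r)) → r≢v (sym v≡r)
                                                  ; (inj₂ (s≡r , _)) → s≢r s≡r }) Hsv)

    reroute-sym : Sym (reroute H s r u v)
    reroute-sym = setEdge-sym H₂ s v true H₂-sym

    degree-reroute-s : degree (reroute H s r u v) s ≡ degree H s
    degree-reroute-s = trans (degree-addEdgeˡ H₂ s v s≢v H₂sv)
                     (trans (cong suc (degree-setEdge-off H₁ r u true s s≢r s≢u))
                            (degree-removeEdgeˡ H s r s≢r Hsr))

    degree-reroute-r : degree (reroute H s r u v) r ≡ degree H r
    degree-reroute-r = trans (degree-setEdge-off H₂ s v true r (≢-sym s≢r) r≢v)
                     (trans (degree-addEdgeˡ H₁ r u r≢u H₁ru)
                            (degree-removeEdgeʳ H s r s≢r (trans (symH r s) Hsr)))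

    degree-reroute-u : degree (reroute H s r u v) u ≡ suc (degree H u)
    degree-reroute-u = trans (degree-setEdge-off H₂ s v true u (≢-sym s≢u) u≢v)
                     (trans (degree-addEdgeʳ H₁ r u r≢u (trans (setEdge-sym H s r false symH u r) H₁ru))
                            (cong suc (degree-setEdge-off H s r false u (≢-sym s≢u) (≢-sym r≢u))))

    degree-reroute-v : degree (reroute H s r u v) v ≡ suc (degree H v)
    degree-reroute-v = trans (degree-addEdgeʳ H₂ s v s≢v (trans (H₂-sym v s) H₂sv))
                     (cong suc (trans (degree-setEdge-off H₁ r u true v (≢-sym r≢v) (≢-sym u≢v))
                                      (degree-setEdge-off H s r false v (≢-sym s≢v) (≢-sym r≢v))))

    degree-reroute-off : ∀ w → w ≢ s → w ≢ r → w ≢ u → w ≢ v → degree (reroute H s r u v) w ≡ degree H w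
    degree-reroute-off w w≢s w≢r w≢u w≢v = trans (degree-setEdge-off H₂ s v true w w≢s w≢v)
      (trans (degree-setEdge-off H₁ r u true w w≢r w≢u) (degree-setEdge-off H s r false w w≢s w≢r))

-- Augmentation along alternating walks

data Toward (d d′ c : ℕ) : Set where
  up   : d′ ≡ suc d → d < c → Toward d d′ c
  down : d ≡ suc d′ → c < d → Toward d d′ c

module _ {n : ℕ} where

  data Raised (d c d′ : Fin n → ℕ) (x : Fin n) : Set where
    cycle : d′ x ≡ 2 + d x → 2 + d x ≤ c x → (∀ w → w ≢ x → d′ w ≡ d w) → Raised d c d′ x
    path  : d′ x ≡ suc (d x) → (z : Fin n) → z ≢ x → Toward (d z) (d′ z) (c z) →
            (∀ w → w ≢ x → w ≢ z → d′ w ≡ d w) → Raised d c d′ x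

  data Lowered (d c d′ : Fin n → ℕ) (x : Fin n) : Set where
    cycle : d x ≡ 2 + d′ x → 2 + c x ≤ d x → (∀ w → w ≢ x → d′ w ≡ d w) → Lowered d c d′ x
    path  : d x ≡ suc (d′ x) → (z : Fin n) → z ≢ x → Toward (d z) (d′ z) (c z) →
            (∀ w → w ≢ x → w ≢ z → d′ w ≡ d w) → Lowered d c d′ x

module _ {n : ℕ} {d c d′ : Fin n → ℕ} {x : Fin n} where

  raised-gain : Raised d c d′ x → d x < c x → d x < d′ x × d′ x ≤ c x
  raised-gain (cycle d′x≡ 2+d≤c _) _   = subst (d x <_) (sym d′x≡) (s≤s (n≤1+n _)) , subst (_≤ c x) (sym d′x≡) 2+d≤c
  raised-gain (path d′x≡ _ _ _ _)  d<c = subst (d x <_) (sym d′x≡) ≤-refl , subst (_≤ c x) (sym d′x≡) d<c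

  raised-off : Raised d c d′ x → ∀ w → w ≢ x → d′ w ≡ d w ⊎ Toward (d w) (d′ w) (c w)
  raised-off (cycle _ _ same)          w w≢x = inj₁ (same w w≢x)
  raised-off (path _ z _ toward same) w w≢x with w ≟ z
  ... | yes refl = inj₂ toward
  ... | no w≢z   = inj₁ (same w w≢x w≢z)

complement-≡ : ∀ {m x̄ x ȳ y} k → x̄ + x ≡ m → ȳ + y ≡ m → x̄ ≡ k + ȳ → y ≡ k + x
complement-≡ {m} {x̄} {x} {ȳ} {y} k x̄+x ȳ+y x̄≡k+ȳ = +-cancelʳ-≡ ȳ y (k + x) (begin
  y + ȳ           ≡⟨ +-comm y ȳ ⟩
  ȳ + y           ≡⟨ trans ȳ+y (sym x̄+x) ⟩
  x̄ + x           ≡⟨ cong (_+ x) x̄≡k+ȳ ⟩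
  k + ȳ + x       ≡⟨ +-assoc k ȳ x ⟩
  k + (ȳ + x)     ≡⟨ cong (k +_) (+-comm ȳ x) ⟩
  k + (x + ȳ)     ≡⟨ sym (+-assoc k x ȳ) ⟩
  k + x + ȳ       ∎)
  where open ≡-Reasoning

complement-≤ : ∀ {m x̄ x ȳ y} k → x̄ + x ≡ m → ȳ + y ≡ m → k + ȳ ≤ x̄ → k + x ≤ y
complement-≤ {m} {x̄} {x} {ȳ} {y} k x̄+x ȳ+y k+ȳ≤x̄ = +-cancelʳ-≤ ȳ (k + x) y (begin
  k + x + ȳ       ≡⟨ +-assoc k x ȳ ⟩
  k + (x + ȳ)     ≡⟨ cong (k +_) (+-comm x ȳ) ⟩
  k + (ȳ + x)     ≡⟨ sym (+-assoc k ȳ x) ⟩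
  k + ȳ + x       ≤⟨ +-monoˡ-≤ x k+ȳ≤x̄ ⟩
  x̄ + x           ≡⟨ trans x̄+x (sym ȳ+y) ⟩
  ȳ + y           ≡⟨ +-comm ȳ y ⟩
  y + ȳ           ∎)
  where open ≤-Reasoning

module _ {n m : ℕ} {d̄ d c̄ c ē e : Fin n → ℕ}
         (d̄+d : ∀ w → d̄ w + d w ≡ m) (c̄+c : ∀ w → c̄ w + c w ≡ m) (ē+e : ∀ w → ē w + e w ≡ m) where

  toward-complement : ∀ z → Toward (d̄ z) (ē z) (c̄ z) → Toward (d z) (e z) (c z)
  toward-complement z (up ē≡ d̄<c̄)   =
    down (complement-≡ 1 (ē+e z) (d̄+d z) ē≡) (complement-≤ 1 (c̄+c z) (d̄+d z) d̄<c̄)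
  toward-complement z (down d̄≡ c̄<d̄) =
    up (complement-≡ 1 (d̄+d z) (ē+e z) d̄≡) (complement-≤ 1 (d̄+d z) (c̄+c z) c̄<d̄)

  raised-complement : ∀ x → Raised d̄ c̄ ē x → Lowered d c e x
  raised-complement x (cycle ē≡ le same) =
    cycle (complement-≡ 2 (ē+e x) (d̄+d x) ē≡) (complement-≤ 2 (c̄+c x) (d̄+d x) le)
          (λ w w≢x → complement-≡ 0 (d̄+d w) (ē+e w) (sym (same w w≢x)))
  raised-complement x (path ē≡ z z≢x toward same) =
    path (complement-≡ 1 (ē+e x) (d̄+d x) ē≡) z z≢x (toward-complement z toward)
         (λ w w≢x w≢z → complement-≡ 0 (d̄+d w) (ē+e w) (sym (same w w≢x w≢z)))

module _ {n : ℕ} {d d₁ d₂ c : Fin n → ℕ} {x v : Fin n} (x≢v : x ≢ v) (d<c : d x < c x)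
         (d₁x : d₁ x ≡ suc (d x)) (d₁v : d₁ v ≡ suc (d v)) (d₁-off : ∀ w → w ≢ x → w ≢ v → d₁ w ≡ d w) where

  private
    settle : d₁ v ≡ suc (d₂ v) → ∀ w → w ≢ x → (w ≢ v → d₂ w ≡ d₁ w) → d₂ w ≡ d w
    settle d₁v≡ w w≢x rel with w ≟ v
    ... | yes refl = suc-injective (trans (sym d₁v≡) d₁v)
    ... | no w≢v   = trans (rel w≢v) (d₁-off w w≢x w≢v)

  raise-then-lower : Lowered d₁ c d₂ v → Raised d c d₂ x
  raise-then-lower (cycle d₁v≡ 2+c≤d₁ same) =
    path (trans (same x x≢v) d₁x) v (λ v≡x → x≢v (sym v≡x))
         (down (suc-injective (trans (sym d₁v) d₁v≡)) (≤-pred (subst (2 + c v ≤_) d₁v 2+c≤d₁)))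
         (λ w w≢x w≢v → trans (same w w≢v) (d₁-off w w≢x w≢v))
  raise-then-lower (path d₁v≡ z z≢v toward same) with z ≟ x
  ... | yes refl = at-x toward
    where
    at-x : Toward (d₁ x) (d₂ x) (c x) → Raised d c d₂ x
    at-x (up d₂x≡ d₁x<c)   = cycle (trans d₂x≡ (cong suc d₁x)) (subst (_< c x) d₁x d₁x<c)
                                   (λ w w≢x → settle d₁v≡ w w≢x (λ w≢v → same w w≢v w≢x))
    at-x (down d₁x≡ c<d₁x) = contradiction (≤-pred (subst (c x <_) d₁x c<d₁x)) (<⇒≱ d<c)
  ... | no z≢x = path (trans (same x x≢v λ x≡z → z≢x (sym x≡z)) d₁x) z z≢x
                      (subst (λ t → Toward t (d₂ z) (c z)) (d₁-off z z≢x z≢v) toward)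
                      (λ w w≢x w≢z → settle d₁v≡ w w≢x (λ w≢v → same w w≢v w≢z))

module _ {n : ℕ} where

  record Between (D C D′ : Adj n) : Set where
    field
      keeps  : ∀ u v → D u v ≡ true → C u v ≡ true → D′ u v ≡ true
      within : ∀ u v → D′ u v ≡ true → D u v ≡ true ⊎ C u v ≡ true

  between-trans : ∀ {D C D₁ D₂} → Between D C D₁ → Between D₁ C D₂ → Between D C D₂
  between-trans b₁ b₂ = record
    { keeps  = λ u v Duv Cuv → Between.keeps b₂ u v (Between.keeps b₁ u v Duv Cuv) Cuv
    ; within = λ u v D₂uv → [ Between.within b₁ u v , inj₂ ]′ (Between.within b₂ u v D₂uv)
    }

  between-∁ : ∀ {D C E} → Between (∁ D) (∁ C) E → Between D C (∁ E)
  between-∁ {D} {C} {E} b = record { keeps = keeps ; within = within }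
    where
    keeps : ∀ u v → D u v ≡ true → C u v ≡ true → not (E u v) ≡ true
    keeps u v Duv Cuv with E u v in Euv
    ... | false = refl
    ... | true with Between.within b u v Euv
    ...   | inj₁ ∁Duv = contradiction (trans (sym (cong not Duv)) ∁Duv) λ ()
    ...   | inj₂ ∁Cuv = contradiction (trans (sym (cong not Cuv)) ∁Cuv) λ ()
    within : ∀ u v → not (E u v) ≡ true → D u v ≡ true ⊎ C u v ≡ true
    within u v ∁Euv with D u v in Duv | C u v in Cuv
    ... | true  | _     = inj₁ refl
    ... | false | true  = inj₂ refl
    ... | false | false =
      contradiction (trans (sym (cong not (Between.keeps b u v (cong not Duv) (cong not Cuv)))) ∁Euv) λ ()

  between-addEdge : ∀ {D C} p q → Sym C → C p q ≡ true → Between D C (setEdge D p q true)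
  between-addEdge {D} {C} p q symC Cpq = record { keeps = keeps ; within = within }
    where
    keeps : ∀ u v → D u v ≡ true → C u v ≡ true → setEdge D p q true u v ≡ true
    keeps u v Duv _ with isPair p q u v
    ... | true  = refl
    ... | false = Duv
    within : ∀ u v → setEdge D p q true u v ≡ true → D u v ≡ true ⊎ C u v ≡ true
    within u v D₁uv with isPair p q u v in pair
    ... | false = inj₁ D₁uv
    ... | true with isPair-true p q u v pair
    ...   | inj₁ (refl , refl) = inj₂ Cpq
    ...   | inj₂ (refl , refl) = inj₂ (trans (symC u v) Cpq)

  distance : Adj n → Adj n → ℕ
  distance D C = sum (λ u → count (λ v → D u v xor C u v))

  distance-∁ : ∀ D C → distance (∁ D) (∁ C) ≡ distance D C
  distance-∁ D C = sum-cong-≗ (λ u → count-cong _ _ (λ v → not-xor-not (D u v) (C u v)))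
    where
    not-xor-not : ∀ b c → (not b xor not c) ≡ (b xor c)
    not-xor-not true  c = refl
    not-xor-not false c = not-involutive c

  distance-addEdge : ∀ D C p q → Sym C → p ≢ q → D p q ≡ false → C p q ≡ true →
                     distance (setEdge D p q true) C < distance D C
  distance-addEdge D C p q symC p≢q Dpq Cpq = sum-<-at _ _ p row-p row-other
    where
    D₁ = setEdge D p q true
    row-p : count (λ v → D₁ p v xor C p v) < count (λ v → D p v xor C p v)
    row-p = ≤-reflexive (begin
      suc (count new)           ≡⟨ +-comm 1 _ ⟩
      count new + 1             ≡⟨ cong (λ b → count new + 𝟙 b) (sym (cong₂ _xor_ Dpq Cpq)) ⟩
      count new + 𝟙 (old q)     ≡⟨ count-update new old q agree ⟩
      count old + 𝟙 (new q)     ≡⟨ cong (λ b → count old + 𝟙 b) (cong₂ _xor_ (setEdge-on D p q true) Cpq) ⟩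
      count old + 0             ≡⟨ +-identityʳ _ ⟩
      count old                 ∎)
      where
      open ≡-Reasoning
      new old : Fin n → Bool
      new v = D₁ p v xor C p v
      old v = D p v xor C p v
      agree : ∀ v → v ≢ q → new v ≡ old v
      agree v v≢q = cong (_xor C p v) (setEdge-off D p q true p v
        λ { (inj₁ (_ , v≡q)) → v≢q v≡q ; (inj₂ (p≡q , _)) → p≢q p≡q })
    row-other : ∀ u → u ≢ p → count (λ v → D₁ u v xor C u v) ≤ count (λ v → D u v xor C u v)
    row-other u u≢p = count-mono _ _ differs
      where
      differs : ∀ v → (D₁ u v xor C u v) ≡ true → (D u v xor C u v) ≡ true
      differs v h with isPair p q u v in pair
      ... | false = h
      ... | true with isPair-true p q u v pair
      ...   | inj₁ (u≡p , _)     = contradiction u≡p u≢p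
      ...   | inj₂ (refl , refl) = contradiction (trans (sym (cong not (trans (symC u v) Cpq))) h) λ ()

  SameDiag : Adj n → Adj n → Set
  SameDiag D C = ∀ u → D u u ≡ C u u

  record Augmentation (D C : Adj n) (x : Fin n) : Set where
    constructor augmentation
    field
      graph     : Adj n
      graph-sym : Sym graph
      between   : Between D C graph
      raised    : Raised (degree D) (degree C) (degree graph) x
  open Augmentation public

  -- Add an edge xv of C missing from D. If v thereby exceeds its C-degree, then in the complements
  -- v is below its target; augmenting there and complementing back lowers v again. Each round adds
  -- an edge of C, so the distance bounds the recursion.
  augment-within : ∀ k D C → Sym D → Sym C → SameDiag D C → distance D C ≤ k →
                   ∀ x → degree D x < degree C x → Augmentation D C x
  augment-within k D C symD symC diag bound x lt = extend (count-witness (D x) (C x) lt)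
    where
    extend : (Σ (Fin n) λ v → C x v ≡ true × D x v ≡ false) → Augmentation D C x
    extend (v , Cxv , Dxv) = decide (degree D v <? degree C v)
      where
      x≢v : x ≢ v
      x≢v refl = contradiction (trans (sym Dxv) (trans (diag x) Cxv)) λ ()
      D₁ = setEdge D x v true
      sym₁ = setEdge-sym D x v true symD
      between₁ = between-addEdge x v symC Cxv
      d₁x = degree-addEdgeˡ D x v x≢v Dxv
      d₁v = degree-addEdgeʳ D x v x≢v (trans (symD v x) Dxv)
      d₁-off = degree-setEdge-off D x v true
      closer = distance-addEdge D C x v symC x≢v Dxv Cxv
      decide : Dec (degree D v < degree C v) → Augmentation D C x
      decide (yes dv<cv) = augmentation D₁ sym₁ between₁ (path d₁x v (λ v≡x → x≢v (sym v≡x)) (up d₁v dv<cv) d₁-off)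
      decide (no dv≮cv)  = descend k bound
        where
        descend : ∀ j → distance D C ≤ j → Augmentation D C x
        descend zero    ≤0   = contradiction (≤-trans closer ≤0) λ ()
        descend (suc j) ≤1+j =
          augmentation (∁ E) (∁-sym E (graph-sym rec)) (between-trans between₁ (between-∁ (between rec)))
          (raise-then-lower x≢v lt d₁x d₁v d₁-off
            (raised-complement (degree-∁ D₁) (degree-∁ C) (degree+degree-∁ E) v (raised rec)))
          where
          v-over : degree (∁ D₁) v < degree (∁ C) v
          v-over = complement-≤ 1 (degree+degree-∁ D₁ v) (degree+degree-∁ C v)
                     (subst (suc (degree C v) ≤_) (sym d₁v) (s≤s (≮⇒≥ dv≮cv)))
          rec : Augmentation (∁ D₁) (∁ C) v
          rec = augment-within j (∁ D₁) (∁ C) (∁-sym D₁ sym₁) (∁-sym C symC)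
                  (λ u → cong not (trans (setEdge-diag D x v true x≢v u) (diag u)))
                  (subst (_≤ j) (sym (distance-∁ D₁ C)) (≤-pred (≤-trans closer ≤1+j))) v v-over
          E = graph rec

  augment : ∀ D C → Sym D → Sym C → SameDiag D C → ∀ x → degree D x < degree C x → Augmentation D C x
  augment D C symD symC diag = augment-within (distance D C) D C symD symC diag ≤-refl

-- Improving bounded subgraphs of G − e

∸-≡suc : ∀ {m d} → d < m → m ∸ d ≡ suc (m ∸ suc d)
∸-≡suc {suc m} {zero}  _         = refl
∸-≡suc {suc m} {suc d} (s≤s d<m) = ∸-≡suc d<m

∸-≤suc : ∀ m d → m ∸ d ≤ suc (m ∸ suc d)
∸-≤suc zero    zero    = z≤n
∸-≤suc zero    (suc d) = z≤n
∸-≤suc (suc m) zero    = ≤-refl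
∸-≤suc (suc m) (suc d) = ∸-≤suc m d

module _ (a b : ℕ) (a<b : a < b) {n : ℕ} (G : Graph n) (x y : Fin n) (x~y : T (adj G x y)) where

  A : Adj n
  A = adj G

  E : Adj n
  E = delEdge A x y

  Axy : A x y ≡ true
  Axy = Equivalence.to T-≡ x~y

  x≢y : x ≢ y
  x≢y refl = contradiction (trans (sym (irrefl G x)) Axy) λ ()

  E-sym : Sym E
  E-sym u v = cong₂ _∧_ (Graph.sym G u v) (cong not (isPair-sym x y u v))

  E-intro : ∀ u v → A u v ≡ true → ¬ Pair x y u v → E u v ≡ true
  E-intro u v Auv ¬pair = cong₂ _∧_ Auv (cong not (isPair-false x y u v ¬pair))

  E-≢ : ∀ {u v} → E u v ≡ true → u ≢ v
  E-≢ {u} Euu refl = contradiction (trans (sym Euu) (cong (_∧ _) (irrefl G u))) λ ()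

  data Ends : Fin n → Fin n → Set where
    xy : Ends x y
    yx : Ends y x

  ends-≢ : ∀ {s r} → Ends s r → s ≢ r
  ends-≢ xy = x≢y
  ends-≢ yx = ≢-sym x≢y

  ends-swap : ∀ {s r} → Ends s r → Ends r s
  ends-swap xy = yx
  ends-swap yx = xy

  ends-A : ∀ {s r} → Ends s r → A s r ≡ true
  ends-A xy = Axy
  ends-A yx = trans (Graph.sym G y x) Axy

  ends-E : ∀ {s r} → Ends s r → E s r ≡ false
  ends-E xy = trans (cong (A x y ∧_) (cong not (isPair-refl x y))) (∧-zeroʳ (A x y))
  ends-E yx = trans (E-sym y x) (ends-E xy)

  ends-neighbour : ∀ {s r u} → Ends s r → E s u ≡ true → u ≢ r
  ends-neighbour ends Esu refl = contradiction (trans (sym Esu) (ends-E ends)) λ ()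

  ends-absent : ∀ {s r} (H : Adj n) → Sym H → Ends s r → H s r ≡ false → H x y ≡ false
  ends-absent H symH xy Hsr = Hsr
  ends-absent H symH yx Hsr = trans (symH x y) Hsr

  ends-Pair : ∀ {s r u v} → Ends s r → Pair x y u v → Pair s r u v
  ends-Pair xy pair = pair
  ends-Pair yx (inj₁ uv) = inj₂ uv
  ends-Pair yx (inj₂ uv) = inj₁ uv

  ends-¬Pair : ∀ {s r v} → Ends s r → v ≢ r → ¬ Pair x y s v
  ends-¬Pair xy v≢y (inj₁ (_ , v≡y))  = v≢y v≡y
  ends-¬Pair xy v≢y (inj₂ (x≡y , _))  = x≢y x≡y
  ends-¬Pair yx v≢x (inj₁ (y≡x , _))  = x≢y (sym y≡x)
  ends-¬Pair yx v≢x (inj₂ (_ , v≡x))  = v≢x v≡x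

  record Bounded : Set where
    field
      edges     : Adj n
      edges-sym : Sym edges
      edges⊆E   : ∀ u v → edges u v ≡ true → E u v ≡ true
      degree≤b  : ∀ w → degree edges w ≤ b
  open Bounded

  dg : Bounded → Fin n → ℕ
  dg D = degree (edges D)

  isEnd : Fin n → Bool
  isEnd w = does (w ≟ x) ∨ does (w ≟ y)

  weight : Fin n → ℕ
  weight w = if isEnd w then 1 else 2

  weight-end : ∀ w → isEnd w ≡ true → weight w ≡ 1
  weight-end _ end = cong (λ e → if e then 1 else 2) end

  weight-inner : ∀ w → isEnd w ≡ false → weight w ≡ 2
  weight-inner _ inner = cong (λ e → if e then 1 else 2) inner

  cost : Fin n → ℕ → ℕ
  cost w d = weight w * (a ∸ d)

  potential : Bounded → ℕ
  potential D = sum (λ w → cost w (dg D w))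

  Improvement : Bounded → Set
  Improvement D = Σ Bounded λ D′ → potential D′ < potential D

  cost-anti : ∀ w {d d′} → d ≤ d′ → cost w d′ ≤ cost w d
  cost-anti w d≤d′ = *-monoʳ-≤ (weight w) (∸-monoʳ-≤ a d≤d′)

  cost-< : ∀ w {d d′} → d < a → d < d′ → cost w d′ < cost w d
  cost-< w {d} {d′} d<a d<d′ =
    weighted (isEnd w) (≤-<-trans (∸-monoʳ-≤ a d<d′) (∸-monoʳ-< {a} {suc d} {d} ≤-refl d<a))
    where
    weighted : ∀ e → a ∸ d′ < a ∸ d → (if e then 1 else 2) * (a ∸ d′) < (if e then 1 else 2) * (a ∸ d)
    weighted true  lt = *-monoʳ-< 1 lt
    weighted false lt = *-monoʳ-< 2 lt

  cost-saturated : ∀ w {d} → a ≤ d → cost w d ≡ 0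
  cost-saturated w {d} a≤d = trans (cong (weight w *_) (m≤n⇒m∸n≡0 a≤d)) (*-zeroʳ (weight w))

  harmless-down : ∀ {d d′ c} → d ≡ suc d′ → c < d → a ≤ c ⊎ a < d → a ≤ d′
  harmless-down d≡ c<d (inj₁ a≤c) = ≤-pred (subst (a <_) d≡ (≤-<-trans a≤c c<d))
  harmless-down d≡ c<d (inj₂ a<d) = ≤-pred (subst (a <_) d≡ a<d)

  cost-toward : ∀ w {d d′ c} → Toward d d′ c → a ≤ c ⊎ a < d → cost w d′ ≤ cost w d
  cost-toward w {d} (up d′≡ _) _        = cost-anti w (subst (d ≤_) (sym d′≡) (n≤1+n d))
  cost-toward w (down d≡ c<d) harmless  = ≤-trans (≤-reflexive (cost-saturated w (harmless-down d≡ c<d harmless))) z≤n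

  isEnd-false : ∀ {w} → w ≢ x → w ≢ y → isEnd w ≡ false
  isEnd-false {w} w≢x w≢y with w ≟ x | w ≟ y
  ... | yes w≡x | _       = contradiction w≡x w≢x
  ... | no _    | yes w≡y = contradiction w≡y w≢y
  ... | no _    | no _    = refl

  isEnd-≢ : ∀ {w} → isEnd w ≡ false → w ≢ x × w ≢ y
  isEnd-≢ {w} e with w ≟ x | w ≟ y
  ... | yes _   | _       = contradiction e λ ()
  ... | no _    | yes _   = contradiction e λ ()
  ... | no w≢x  | no w≢y  = w≢x , w≢y

  cost-gain₂ : ∀ w {d} → isEnd w ≡ false → d < a → cost w (suc d) + 2 ≤ cost w d
  cost-gain₂ w {d} inner d<a = ≤-reflexive (begin
    cost w (suc d) + 2        ≡⟨ cong (λ k → k * (a ∸ suc d) + 2) (weight-inner w inner) ⟩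
    2 * (a ∸ suc d) + 2       ≡⟨ +-comm _ 2 ⟩
    2 + 2 * (a ∸ suc d)       ≡⟨ sym (*-suc 2 _) ⟩
    2 * suc (a ∸ suc d)       ≡⟨ cong (2 *_) (sym (∸-≡suc d<a)) ⟩
    2 * (a ∸ d)               ≡⟨ cong (λ k → k * (a ∸ d)) (sym (weight-inner w inner)) ⟩
    cost w d                  ∎)
    where open ≡-Reasoning

  cost-loss₁ : ∀ w {d} → isEnd w ≡ true → cost w d ≤ cost w (suc d) + 1
  cost-loss₁ w {d} end = begin
    cost w d                  ≡⟨ cong (λ k → k * (a ∸ d)) (weight-end w end) ⟩
    1 * (a ∸ d)               ≡⟨ *-identityˡ _ ⟩
    a ∸ d                     ≤⟨ ∸-≤suc a d ⟩
    suc (a ∸ suc d)           ≡⟨ +-comm 1 _ ⟩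
    a ∸ suc d + 1             ≡⟨ cong (_+ 1) (sym (*-identityˡ _)) ⟩
    1 * (a ∸ suc d) + 1       ≡⟨ cong (λ k → k * (a ∸ suc d) + 1) (sym (weight-end w end)) ⟩
    cost w (suc d) + 1        ∎
    where open ≤-Reasoning

  edges-irrefl : (D : Bounded) → ∀ u → edges D u u ≡ false
  edges-irrefl D u with edges D u u in Duu
  ... | true  = contradiction refl (E-≢ (edges⊆E D u u Duu))
  ... | false = refl

  extend : (D C : Bounded) (s : Fin n) → dg D s < dg C s → Σ Bounded λ D′ → Raised (dg D) (dg C) (dg D′) s
  extend D C s lt = D′ , raised aug
    where
    aug = augment (edges D) (edges C) (edges-sym D) (edges-sym C)
                  (λ u → trans (edges-irrefl D u) (sym (edges-irrefl C u))) s lt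
    ≤b : ∀ w → degree (graph aug) w ≤ b
    ≤b w with w ≟ s
    ... | yes refl = ≤-trans (proj₂ (raised-gain (raised aug) lt)) (degree≤b C s)
    ... | no w≢s with raised-off (raised aug) w w≢s
    ...   | inj₁ same           = subst (_≤ b) (sym same) (degree≤b D w)
    ...   | inj₂ (up d′≡ d<c)   = subst (_≤ b) (sym d′≡) (≤-trans d<c (degree≤b C w))
    ...   | inj₂ (down d≡ _)    = ≤-trans (n≤1+n _) (subst (_≤ b) d≡ (degree≤b D w))
    D′ : Bounded
    D′ = record
      { edges     = graph aug
      ; edges-sym = graph-sym aug
      ; edges⊆E   = λ u v h → [ edges⊆E D u v , edges⊆E C u v ]′ (Between.within (between aug) u v h)
      ; degree≤b  = ≤b
      }

  improve-harmless : (D C : Bounded) (s p q : Fin n) → s ≢ p → s ≢ q → dg D s < a →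
                     a < dg D p → a < dg D q → (∀ w → w ≢ p → w ≢ q → a ≤ dg C w) → Improvement D
  improve-harmless D C s p q s≢p s≢q s-def p-over q-over C≥a = D′ , sum-<-at _ _ s at-s elsewhere
    where
    s-below : dg D s < dg C s
    s-below = <-≤-trans s-def (C≥a s s≢p s≢q)
    ext = extend D C s s-below
    D′ = proj₁ ext
    at-s : cost s (dg D′ s) < cost s (dg D s)
    at-s = cost-< s s-def (proj₁ (raised-gain (proj₂ ext) s-below))
    harmless : ∀ w → a ≤ dg C w ⊎ a < dg D w
    harmless w with w ≟ p | w ≟ q
    ... | yes refl | _        = inj₂ p-over
    ... | no _     | yes refl = inj₂ q-over
    ... | no w≢p   | no w≢q   = inj₁ (C≥a w w≢p w≢q)
    elsewhere : ∀ w → w ≢ s → cost w (dg D′ w) ≤ cost w (dg D w)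
    elsewhere w w≢s with raised-off (proj₂ ext) w w≢s
    ... | inj₁ same   = ≤-reflexive (cong (cost w) same)
    ... | inj₂ toward = cost-toward w toward (harmless w)

  module AddEdge (D : Bounded) {p q : Fin n} (Epq : E p q ≡ true) (Dpq : edges D p q ≡ false)
                 (p-room : dg D p < b) (q-room : dg D q < b) where

    p≢q : p ≢ q
    p≢q = E-≢ Epq

    added : Adj n
    added = setEdge (edges D) p q true

    added-p : degree added p ≡ suc (dg D p)
    added-p = degree-addEdgeˡ (edges D) p q p≢q Dpq

    added-q : degree added q ≡ suc (dg D q)
    added-q = degree-addEdgeʳ (edges D) p q p≢q (trans (edges-sym D q p) Dpq)

    added-off : ∀ w → w ≢ p → w ≢ q → degree added w ≡ dg D w
    added-off = degree-setEdge-off (edges D) p q true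

    D⁺ : Bounded
    D⁺ = record
      { edges     = added
      ; edges-sym = setEdge-sym (edges D) p q true (edges-sym D)
      ; edges⊆E   = ⊆E
      ; degree≤b  = ≤b
      }
      where
      ⊆E : ∀ u v → added u v ≡ true → E u v ≡ true
      ⊆E u v h with isPair p q u v in pair
      ... | false = edges⊆E D u v h
      ... | true with isPair-true p q u v pair
      ...   | inj₁ (refl , refl) = Epq
      ...   | inj₂ (refl , refl) = trans (E-sym u v) Epq
      ≤b : ∀ w → degree added w ≤ b
      ≤b w = cases (w ≟ p) (w ≟ q)
        where
        cases : Dec (w ≡ p) → Dec (w ≡ q) → degree added w ≤ b
        cases (yes refl) _          = subst (_≤ b) (sym added-p) p-room
        cases (no _)     (yes refl) = subst (_≤ b) (sym added-q) q-room
        cases (no w≢p)   (no w≢q)   = subst (_≤ b) (sym (added-off w w≢p w≢q)) (degree≤b D w)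

    dg-≤-dg⁺ : ∀ w → dg D w ≤ dg D⁺ w
    dg-≤-dg⁺ w = cases (w ≟ p) (w ≟ q)
      where
      cases : Dec (w ≡ p) → Dec (w ≡ q) → dg D w ≤ dg D⁺ w
      cases (yes refl) _          = subst (dg D p ≤_) (sym added-p) (n≤1+n _)
      cases (no _)     (yes refl) = subst (dg D q ≤_) (sym added-q) (n≤1+n _)
      cases (no w≢p)   (no w≢q)   = ≤-reflexive (sym (added-off w w≢p w≢q))

    potential-≤ : potential D⁺ ≤ potential D
    potential-≤ = sum-mono _ _ (λ w → cost-anti w (dg-≤-dg⁺ w))

    potential-< : dg D p < a → potential D⁺ < potential D
    potential-< p-def = sum-<-at _ _ p (cost-< p p-def (subst (dg D p <_) (sym added-p) ≤-refl))
                                       (λ w _ → cost-anti w (dg-≤-dg⁺ w))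

  allBut₂-≢ : ∀ {p q w : Fin n} → T (allBut₂ p q w) → w ≢ p × w ≢ q
  allBut₂-≢ {p} {q} {w} h with w ≟ p | w ≟ q
  ... | yes _  | _      = ⊥-elim h
  ... | no _   | yes _  = ⊥-elim h
  ... | no w≢p | no w≢q = w≢p , w≢q

  allBut₂-intro : ∀ {p q w : Fin n} → w ≢ p → w ≢ q → T (allBut₂ p q w)
  allBut₂-intro {p} {q} {w} w≢p w≢q with w ≟ p | w ≟ q
  ... | yes w≡p | _       = w≢p w≡p
  ... | no _    | yes w≡q = w≢q w≡q
  ... | no _    | no _    = tt

  module FactorAvoiding {p q : Fin n} (F : HasFactorMinus₂ G p q a b) where

    H : Adj n
    H = Factor.H F

    H-sym : Sym H
    H-sym = Factor.H-sym F

    H⊆A : ∀ u v → H u v ≡ true → A u v ≡ true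
    H⊆A u v Huv = Equivalence.to T-≡ (Factor.H-sub F u v (Equivalence.from T-≡ Huv))

    H-avoids : ∀ u v → H u v ≡ true → u ≢ p × u ≢ q
    H-avoids u v Huv = allBut₂-≢ (proj₁ (Factor.H-inS F u v (Equivalence.from T-≡ Huv)))

    H-at-p : ∀ v → H p v ≡ false
    H-at-p v with H p v in Hpv
    ... | true  = contradiction refl (proj₁ (H-avoids p v Hpv))
    ... | false = refl

    H-at-q : ∀ v → H q v ≡ false
    H-at-q v with H q v in Hqv
    ... | true  = contradiction refl (proj₂ (H-avoids q v Hqv))
    ... | false = refl

    degree-H-≥a : ∀ w → w ≢ p → w ≢ q → a ≤ degree H w
    degree-H-≥a w w≢p w≢q = subst (a ≤_) (deg≡degree H w) (Factor.deg-lo F w (allBut₂-intro w≢p w≢q))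

    degree-H-≤b : ∀ w → degree H w ≤ b
    degree-H-≤b w with w ≟ p | w ≟ q
    ... | yes refl | _        = subst (_≤ b) (sym (count-none (H p) H-at-p)) z≤n
    ... | no _     | yes refl = subst (_≤ b) (sym (count-none (H q) H-at-q)) z≤n
    ... | no w≢p   | no w≢q   = subst (_≤ b) (deg≡degree H w) (Factor.deg-hi F w (allBut₂-intro w≢p w≢q))

    H⊆E : H x y ≡ false → ∀ u v → H u v ≡ true → E u v ≡ true
    H⊆E Hxy u v Huv = E-intro u v (H⊆A u v Huv) λ
      { (inj₁ (refl , refl)) → contradiction (trans (sym Hxy) Huv) λ ()
      ; (inj₂ (refl , refl)) → contradiction (trans (sym Hxy) (trans (H-sym x y) Huv)) λ () }

    bounded : H x y ≡ false → Bounded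
    bounded Hxy = record { edges = H ; edges-sym = H-sym ; edges⊆E = H⊆E Hxy ; degree≤b = degree-H-≤b }

    module _ {s r : Fin n} (ends : Ends s r) (p≢q : p ≢ q) (Hsr : H s r ≡ true)
             (Erp : E r p ≡ true) (Esq : E s q ≡ true) where

      private
        1≤b : 1 ≤ b
        1≤b = ≤-trans (s≤s z≤n) a<b

      open Reroute H H-sym (ends-≢ ends) (≢-sym (ends-neighbour (ends-swap ends) Erp)) (E-≢ Esq) (E-≢ Erp)
                   (≢-sym (ends-neighbour ends Esq)) p≢q Hsr
                   (trans (H-sym r p) (H-at-p r)) (trans (H-sym s q) (H-at-q s))

      rerouted : Bounded
      rerouted = record
        { edges     = reroute H s r p q
        ; edges-sym = reroute-sym
        ; edges⊆E   = ⊆E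
        ; degree≤b  = ≤b
        }
        where
        ⊆E : ∀ i j → reroute H s r p q i j ≡ true → E i j ≡ true
        ⊆E i j h with reroute-true H s r p q i j h
        ... | inj₁ (inj₁ (refl , refl))        = Esq
        ... | inj₁ (inj₂ (refl , refl))        = trans (E-sym i j) Esq
        ... | inj₂ (inj₁ (inj₁ (refl , refl))) = Erp
        ... | inj₂ (inj₁ (inj₂ (refl , refl))) = trans (E-sym i j) Erp
        ... | inj₂ (inj₂ (¬sr , Hij))          = E-intro i j (H⊆A i j Hij) (λ pair → ¬sr (ends-Pair ends pair))
        ≤b : ∀ w → degree (reroute H s r p q) w ≤ b
        ≤b w = cases (w ≟ s) (w ≟ r) (w ≟ p) (w ≟ q)
          where
          cases : Dec (w ≡ s) → Dec (w ≡ r) → Dec (w ≡ p) → Dec (w ≡ q) → degree (reroute H s r p q) w ≤ b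
          cases (yes refl) _ _ _ = subst (_≤ b) (sym degree-reroute-s) (degree-H-≤b s)
          cases (no _) (yes refl) _ _ = subst (_≤ b) (sym degree-reroute-r) (degree-H-≤b r)
          cases (no _) (no _) (yes refl) _ =
            subst (_≤ b) (sym (trans degree-reroute-u (cong suc (count-none (H p) H-at-p)))) 1≤b
          cases (no _) (no _) (no _) (yes refl) =
            subst (_≤ b) (sym (trans degree-reroute-v (cong suc (count-none (H q) H-at-q)))) 1≤b
          cases (no w≢s) (no w≢r) (no w≢p) (no w≢q) =
            subst (_≤ b) (sym (degree-reroute-off w w≢s w≢r w≢p w≢q)) (degree-H-≤b w)

      rerouted-≥a : ∀ w → w ≢ p → w ≢ q → a ≤ dg rerouted w
      rerouted-≥a w w≢p w≢q = cases (w ≟ s) (w ≟ r)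
        where
        cases : Dec (w ≡ s) → Dec (w ≡ r) → a ≤ dg rerouted w
        cases (yes refl) _ = subst (a ≤_) (sym degree-reroute-s) (degree-H-≥a s w≢p w≢q)
        cases (no _) (yes refl) = subst (a ≤_) (sym degree-reroute-r) (degree-H-≥a r w≢p w≢q)
        cases (no w≢s) (no w≢r) = subst (a ≤_) (sym (degree-reroute-off w w≢s w≢r w≢p w≢q)) (degree-H-≥a w w≢p w≢q)

  free : Bounded → Fin n → Fin n → Bool
  free D s w = E s w ∧ not (edges D s w)

  free⇒E : ∀ D {s w} → free D s w ≡ true → E s w ≡ true
  free⇒E D {s} {w} h with E s w
  ... | true  = refl
  ... | false = contradiction h λ ()

  free⇒∉ : ∀ D {s w} → free D s w ≡ true → edges D s w ≡ false
  free⇒∉ D {s} {w} h with edges D s w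
  ... | false = refl
  ... | true  = contradiction (trans (sym h) (∧-zeroʳ (E s w))) λ ()

  degree-E-≤ : (D : Bounded) (s : Fin n) → degree E s ≤ dg D s + count (free D s)
  degree-E-≤ D s = begin
    degree E s                                            ≡⟨ count-∧-split (E s) (edges D s) ⟩
    count (λ w → E s w ∧ edges D s w) + count (free D s)  ≤⟨ +-monoˡ-≤ _ (count-mono _ _ (λ w → ∧-snd (E s w))) ⟩
    dg D s + count (free D s)                             ∎
    where
    open ≤-Reasoning
    ∧-snd : ∀ c {d} → c ∧ d ≡ true → d ≡ true
    ∧-snd true h = h

  free-lower : (D : Bounded) (s : Fin n) → ∀ k → dg D s + k ≤ a + 1 → a + 1 ≤ degree E s → k ≤ count (free D s)
  free-lower D s k bound E-big = +-cancelˡ-≤ (dg D s) k _ (≤-trans bound (≤-trans E-big (degree-E-≤ D s)))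

  empty : Bounded
  empty = record
    { edges     = λ _ _ → false
    ; edges-sym = λ _ _ → refl
    ; edges⊆E   = λ _ _ ()
    ; degree≤b  = λ w → subst (_≤ b) (sym (count-none {n} _ (λ _ → refl))) z≤n
    }

  toFactor : (D : Bounded) → (∀ w → a ≤ dg D w) → HasFactorMinusEdge G x y a b
  toFactor D complete = record
    { H      = edges D
    ; H-sym  = edges-sym D
    ; H-sub  = λ u v h → Equivalence.from T-≡ (edges⊆E D u v (Equivalence.to T-≡ h))
    ; H-inS  = λ _ _ _ → tt , tt
    ; deg-lo = λ v _ → subst (a ≤_) (sym (deg≡degree (edges D) v)) (complete v)
    ; deg-hi = λ v _ → subst (_≤ b) (sym (deg≡degree (edges D) v)) (degree≤b D v)
    }

  module _ (minDeg : minDeg≥ G (a + 2)) where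

    degree-E-end : ∀ {s r} → Ends s r → a + 1 ≤ degree E s
    degree-E-end {s} {r} ends = +-cancelʳ-≤ 1 (a + 1) (degree E s) (begin
      a + 1 + 1                 ≡⟨ +-comm (a + 1) 1 ⟩
      suc (a + 1)               ≡⟨ sym (+-suc a 1) ⟩
      a + 2                     ≤⟨ subst (a + 2 ≤_) (deg≡degree A s) (minDeg s) ⟩
      degree A s                ≡⟨ sym (+-identityʳ _) ⟩
      degree A s + 𝟙 false      ≡⟨ cong (λ c → degree A s + 𝟙 c) (sym (ends-E ends)) ⟩
      degree A s + 𝟙 (E s r)    ≡˘⟨ count-update (E s) (A s) r agree ⟩
      degree E s + 𝟙 (A s r)    ≡⟨ cong (λ c → degree E s + 𝟙 c) (ends-A ends) ⟩
      degree E s + 1            ∎)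
      where
      open ≤-Reasoning
      agree : ∀ v → v ≢ r → E s v ≡ A s v
      agree v v≢r = trans (cong (λ c → A s v ∧ not c) (isPair-false x y s v (ends-¬Pair ends v≢r)))
                          (∧-identityʳ (A s v))

    module _ (factor-minus₂ : (p q : Fin n) → p ≢ q → HasFactorMinus₂ G p q a b) where

      improve-outside : (D : Bounded) (s : Fin n) → s ≢ x → s ≢ y → dg D s < a → Improvement D
      improve-outside D s s≢x s≢y s-def = D′ , decrease (proj₂ ext)
        where
        open FactorAvoiding (factor-minus₂ x y x≢y)
        C = bounded (H-at-p y)
        s-below : dg D s < dg C s
        s-below = <-≤-trans s-def (degree-H-≥a s s≢x s≢y)
        ext = extend D C s s-below
        D′ = proj₁ ext
        unchanged : ∀ {w} → dg D′ w ≡ dg D w → cost w (dg D′ w) ≤ cost w (dg D w)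
        unchanged {w} same = ≤-reflexive (cong (cost w) same)
        loss : ∀ z → Toward (dg D z) (dg D′ z) (dg C z) → cost z (dg D′ z) ≤ cost z (dg D z) + 1
        loss z (up d′≡ _) = ≤-trans (cost-anti z (subst (dg D z ≤_) (sym d′≡) (n≤1+n _))) (m≤m+n _ 1)
        loss z (down d≡ c<d) = by-end (isEnd z) refl
          where
          by-end : ∀ e → isEnd z ≡ e → cost z (dg D′ z) ≤ cost z (dg D z) + 1
          by-end true  end = subst (λ d → cost z (dg D′ z) ≤ cost z d + 1) (sym d≡) (cost-loss₁ z end)
          by-end false end = ≤-trans (≤-reflexive (cost-saturated z (harmless-down d≡ c<d (inj₁ C≥a)))) z≤n
            where
            C≥a : a ≤ dg C z
            C≥a = degree-H-≥a z (proj₁ (isEnd-≢ end)) (proj₂ (isEnd-≢ end))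
        gain : cost s (suc (dg D s)) + 2 ≤ cost s (dg D s)
        gain = cost-gain₂ s (isEnd-false s≢x s≢y) s-def
        decrease : Raised (dg D) (dg C) (dg D′) s → potential D′ < potential D
        decrease r@(cycle _ _ same) =
          sum-<-at _ _ s (cost-< s s-def (proj₁ (raised-gain r s-below))) (λ w w≢s → unchanged (same w w≢s))
        decrease (path d′s≡ z z≢s toward same) =
          sum-<-trade _ _ s z z≢s (subst (λ d → cost s d + 2 ≤ cost s (dg D s)) (sym d′s≡) gain) (loss z toward)
            (λ w w≢s w≢z → unchanged (same w w≢s w≢z))

      improve-avoiding : ∀ {s r} → Ends s r → (D : Bounded) (t : Fin n) → dg D s < a → a < dg D r →
                         E s t ≡ true → a < dg D t → Improvement D
      improve-avoiding {s} {r} ends D t s-def r-over Est t-over =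
        improve-harmless D C s r t (ends-≢ ends) (E-≢ Est) s-def r-over t-over degree-H-≥a
        where
        open FactorAvoiding (factor-minus₂ r t (≢-sym (ends-neighbour ends Est)))
        C = bounded (ends-absent H H-sym ends (trans (H-sym s r) (H-at-p s)))

      improve-rerouting : ∀ {s r} → Ends s r → (D : Bounded) (u v : Fin n) → u ≢ v → E r u ≡ true → E s v ≡ true →
                          b ≤ dg D u → b ≤ dg D v → dg D s < a → Improvement D
      improve-rerouting {s} {r} ends D u v u≢v Eru Esv u-full v-full s-def =
        improve-harmless D (proj₁ target) s u v s≢u (E-≢ Esv) s-def (<-≤-trans a<b u-full) (<-≤-trans a<b v-full)
                         (proj₂ target)
        where
        s≢u : s ≢ u
        s≢u = ≢-sym (ends-neighbour (ends-swap ends) Eru)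
        open FactorAvoiding (factor-minus₂ u v u≢v)
        -- A factor of G − {u, v} may use the deleted edge sr; trading it for ru and sv keeps s and r.
        target : Σ Bounded λ C → ∀ w → w ≢ u → w ≢ v → a ≤ dg C w
        target with H s r in Hsr
        ... | false = bounded (ends-absent H H-sym ends Hsr) , degree-H-≥a
        ... | true  = rerouted ends u≢v Hsr Eru Esv , rerouted-≥a ends u≢v Hsr Eru Esv

      improve-by-partner-edge : ∀ {s r} → Ends s r → (D : Bounded) (t u : Fin n) → dg D s < a → dg D r ≤ a →
                                E s t ≡ true → b ≤ dg D t → E r u ≡ true → edges D r u ≡ false → dg D u < b →
                                Improvement D
      improve-by-partner-edge {s} {r} ends D t u s-def r≤a Est t-full Eru Dru u-room with dg D r <? a
      ... | yes r-def = D⁺ , potential-< r-def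
        where open AddEdge D Eru Dru (≤-<-trans r≤a a<b) u-room
      ... | no r≮a = proj₁ better , <-≤-trans (proj₂ better) potential-≤
        where
        open AddEdge D Eru Dru (≤-<-trans r≤a a<b) u-room
        s≢u : s ≢ u
        s≢u = ≢-sym (ends-neighbour (ends-swap ends) Eru)
        t≢u : t ≢ u
        t≢u t≡u = <⇒≱ u-room (subst (λ w → b ≤ dg D w) t≡u t-full)
        better : Improvement D⁺
        better = improve-avoiding ends D⁺ t
          (subst (_< a) (sym (added-off s (ends-≢ ends) s≢u)) s-def)
          (subst (a <_) (sym added-p) (s≤s (≮⇒≥ r≮a)))
          Est
          (subst (a <_) (sym (added-off t (ends-neighbour ends Est) t≢u)) (<-≤-trans a<b t-full))

      improve-at-end-saturated : ∀ {s r} → Ends s r → (D : Bounded) → dg D s < a →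
                                 (∀ w → free D s w ≡ true → b ≤ dg D w) → Improvement D
      improve-at-end-saturated {s} {r} ends D s-def saturated = by-partner (a <? dg D r)
        where
        two-free : 2 ≤ count (free D s)
        two-free = free-lower D s 2 (subst₂ _≤_ (+-comm 2 (dg D s)) (+-comm 1 a) (s≤s s-def)) (degree-E-end ends)
        t = proj₁ (count-nonempty (free D s) (≤-trans (s≤s z≤n) two-free))
        ft = proj₂ (count-nonempty (free D s) (≤-trans (s≤s z≤n) two-free))
        by-partner : Dec (a < dg D r) → Improvement D
        by-partner (yes r-over) =
          improve-avoiding ends D t s-def r-over (free⇒E D ft) (<-≤-trans a<b (saturated t ft))
        by-partner (no r≮a) with count-nonempty (free D r) (free-lower D r 1 (+-monoˡ-≤ 1 (≮⇒≥ r≮a)) E-big)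
          where
          E-big : a + 1 ≤ degree E r
          E-big = degree-E-end (ends-swap ends)
        ... | u , fu with dg D u <? b
        ...   | yes u-room = improve-by-partner-edge ends D t u s-def (≮⇒≥ r≮a) (free⇒E D ft) (saturated t ft)
                                                       (free⇒E D fu) (free⇒∉ D fu) u-room
        ...   | no u≮b with count-avoiding (free D s) two-free u
        ...     | v , v≢u , fv = improve-rerouting ends D u v (≢-sym v≢u) (free⇒E D fu) (free⇒E D fv)
                                                   (≮⇒≥ u≮b) (saturated v fv) s-def

      improve-at-end : ∀ {s r} → Ends s r → (D : Bounded) → dg D s < a → Improvement D
      improve-at-end {s} ends D s-def with any? (λ w → (free D s w ≟ᵇ true) ×-dec (dg D w <? b))
      ... | yes (w , fw , w-room) = D⁺ , potential-< s-def
        where open AddEdge D (free⇒E D fw) (free⇒∉ D fw) (<-trans s-def a<b) w-room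
      ... | no none = improve-at-end-saturated ends D s-def (λ w fw → ≮⇒≥ λ w-room → none (w , fw , w-room))

      improve : (D : Bounded) → (∀ w → a ≤ dg D w) ⊎ Improvement D
      improve D with any? (λ w → dg D w <? a)
      ... | no none = inj₁ (λ w → ≮⇒≥ λ w-def → none (w , w-def))
      ... | yes (s , s-def) with s ≟ x | s ≟ y
      ...   | yes refl | _        = inj₂ (improve-at-end xy D s-def)
      ...   | no _     | yes refl = inj₂ (improve-at-end yx D s-def)
      ...   | no s≢x   | no s≢y   = inj₂ (improve-outside D s s≢x s≢y s-def)

      descend : (D : Bounded) → Acc _<_ (potential D) → HasFactorMinusEdge G x y a b
      descend D (acc smaller) with improve D
      ... | inj₁ complete  = toFactor D complete
      ... | inj₂ (D′ , lt) = descend D′ (smaller lt)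

      G−e-has-factor : HasFactorMinusEdge G x y a b
      G−e-has-factor = descend empty (<-wellFounded (potential empty))

theorem8 : (a b : ℕ) → 1 ≤ a → a < b → (n : ℕ) → (G : Graph n) →
    minDeg≥ G (a + 2) →
    ((x y : Fin n) → x ≢ y → HasFactorMinus₂ G x y a b) →
    (x y : Fin n) → T (adj G x y) → HasFactorMinusEdge G x y a b
theorem8 a b _ a<b n G minDeg factor-minus₂ x y x~y = G−e-has-factor a b a<b G x y x~y minDeg factor-minus₂
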